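{- For $g\in\mathcal{F}_0$ and $f_1,f_2\in\mathcal{F}_1$, the triple $\big(g(z^2),\tfrac{f_1(z^2)}{z},\tfrac{f_2(z^2)}{z}\big)$ is a Double Riordan array (and every Double Riordan array has this form). The map $\chi$ from the Double Riordan group to the Triple Riordan group defined by \[ \chi\Big(g(z^2),\tfrac{f_1(z^2)}{z},\tfrac{f_2(z^2)}{z}\Big)=\Big(g(z^3),\ z,\ \tfrac{f_1(z^3)}{z^2},\ \tfrac{f_2(z^3)}{z^2}\Big) \] is a group monomorphism. Consequently the Double Riordan group is isomorphic to the type-1 almost Appell subgroup of the Triple Riordan group. The Double Riordan group is also isomorphic to the type-2 and to the type-3 almost Appell subgroups of the Triple Riordan group.
   Context: Work with formal power series in $z$ over $\mathbb{C}$. Let $\mathcal{F}_0$ be the set of formal power series with nonzero constant term, and $\mathcal{F}_1$ the set of formal power series with zero constant term and nonzero coefficient of $z$. For $k\ge1$, a $k$-Riordan array $(g,f_1,\dots,f_k)$ consists of $g(z)=\tilde g(z^k)$ with $\tilde g\in\mathcal{F}_0$ and $f_i(z)=\hat f_i(z^k)/z^{k-1}$ with $\hat f_i\in\mathcal{F}_1$; it is the infinite lower-triangular matrix whose column $0$ has generating function $g$ and whose column $n\ge1$ has generating function $g\prod_{m=1}^{n} f_{((m-1)\bmod k)+1}$ (multiplier functions applied cyclically). The $k$-Riordan group is the set of these arrays under matrix multiplication, given by $(g,f_1,\dots,f_k)*(G,F_1,\dots,F_k)=\big(g\,G(h),\ \tfrac{f_1}{h}F_1(h),\dots,\tfrac{f_k}{h}F_k(h)\big)$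 where $h\in\mathcal{F}_1$ satisfies $h^k=f_1\cdots f_k$ (independent of the choice of root). For $k=2$ this is the Double Riordan group (arrays $(g,f_1,f_2)$ with $g$ even, $f_1,f_2$ odd), for $k=3$ the Triple Riordan group. The type-1, type-2, type-3 almost Appell subgroups of the Triple Riordan group are, respectively, the sets of $3$-Riordan arrays $\big(g(z^3),z,\tfrac{f_1(z^3)}{z^2},\tfrac{f_2(z^3)}{z^2}\big)$, $\big(g(z^3),\tfrac{f_1(z^3)}{z^2},z,\tfrac{f_2(z^3)}{z^2}\big)$, $\big(g(z^3),\tfrac{f_1(z^3)}{z^2},\tfrac{f_2(z^3)}{z^2},z\big)$ with $g\in\mathcal{F}_0$, $f_1,f_2\in\mathcal{F}_1$ (i.e. the multiplier function $z$ is placed in the first, second or third position). -}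

module Defs where

open import Level using (0ℓ)
open import Data.Nat as ℕ using (ℕ; zero; suc)
open import Data.Nat.DivMod using (_/_; _%_; _mod_)
open import Data.Fin as F using (Fin)
open import Data.Vec using (Vec; lookup)
open import Data.Product using (Σ; ∃; _×_; _,_)
open import Relation.Nullary using (¬_; yes; no)
open import Relation.Binary.PropositionalEquality using (_≡_)
open import Algebra.Bundles using (CommutativeRing)

module RingHelpers (R : CommutativeRing 0ℓ 0ℓ) where
  open CommutativeRing R

  pow : Carrier → ℕ → Carrier
  pow x zero    = 1#
  pow x (suc k) = x * pow x k

  natCast : ℕ → Carrier
  natCast zero    = 0#
  natCast (suc n) = 1# + natCast n

  Σ≤ : ℕ → (ℕ → Carrier) → Carrier
  Σ≤ zero    f = f 0
  Σ≤ (suc n) f = Σ≤ n f + f (suc n)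

  monicEval : ∀ n → Vec Carrier (suc n) → Carrier → Carrier
  monicEval n a x = pow x (suc n) + Σ≤ n (λ i → coeff i * pow x i)
    where
      coeff : ℕ → Carrier
      coeff i with i ℕ.<? suc n
      ... | yes p = lookup a (F.fromℕ< p)
      ... | no _  = 0#

-- The scalar field: an algebraically closed field of characteristic 0
-- (stand-in for ℂ, which agda-stdlib does not provide).

record ACF0 : Set₁ where
  field
    cring : CommutativeRing 0ℓ 0ℓ
  open CommutativeRing cring public
  open RingHelpers cring public
  field
    1≉0       : ¬ (1# ≈ 0#)
    inverse   : ∀ x → ¬ (x ≈ 0#) → Σ Carrier λ y → x * y ≈ 1#
    char0     : ∀ n → ¬ (natCast (suc n) ≈ 0#)
    algClosed : ∀ n (a : Vec Carrier (suc n)) →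
                  Σ Carrier λ x → monicEval n a x ≈ 0#

module Riordan (K : ACF0) where
  open ACF0 K

  FPS : Set
  FPS = ℕ → Carrier

  _≋_ : FPS → FPS → Set
  a ≋ b = ∀ n → a n ≈ b n

  Z : FPS
  Z zero          = 0#
  Z (suc zero)    = 1#
  Z (suc (suc _)) = 0#

  _⋆_ : FPS → FPS → FPS
  (a ⋆ b) n = Σ≤ n (λ i → a i * b (n ℕ.∸ i))

  -- a(z^k), for k = suc m
  spread : ℕ → FPS → FPS
  spread m a n with n % suc m ℕ.≟ 0
  ... | yes _ = a (n / suc m)
  ... | no  _ = 0#

  -- a(z) / z^m   (used only when the first m coefficients vanish)
  divZ : ℕ → FPS → FPS
  divZ m a n = a (n ℕ.+ m)

  InF0 : FPS → Set
  InF0 a = ¬ (a 0 ≈ 0#)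

  InF1 : FPS → Set
  InF1 a = (a 0 ≈ 0#) × ¬ (a 1 ≈ 0#)

  -- Data of a k-Riordan array with k = suc m:
  --   g(z) = g̃(z^k),  f_i(z) = f̂_i(z^k) / z^(k-1),  i ∈ Fin k
  record KRiordan (m : ℕ) : Set where
    constructor kR
    field
      g̃    : FPS
      g̃∈F0 : InF0 g̃
      f̂    : Fin (suc m) → FPS
      f̂∈F1 : ∀ i → InF1 (f̂ i)
  open KRiordan public

  Mat : Set
  Mat = ℕ → ℕ → Carrier

  _≈M_ : Mat → Mat → Set
  A ≈M B = ∀ n j → A n j ≈ B n j

  _·_ : Mat → Mat → Mat
  (A · B) n j = Σ≤ n (λ i → A n i * B i j)

  -- the multiplier functions f_1,…,f_k  (index i ∈ Fin k is f_{i+1})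
  mult : ∀ {m} → KRiordan m → Fin (suc m) → FPS
  mult {m} R i = divZ m (spread m (f̂ R i))

  column : ∀ {m} → KRiordan m → ℕ → FPS
  column {m} R zero    = spread m (g̃ R)
  column {m} R (suc n) = column R n ⋆ mult R (n mod suc m)

  array : ∀ {m} → KRiordan m → Mat
  array R n j = column R j n

  DR TR : Set
  DR = KRiordan 1
  TR = KRiordan 2

  -- z as a triple-Riordan multiplier function: z = f̂(z³)/z² with f̂ = z
  -- Type-j almost Appell arrays (j = 0,1,2 for type 1,2,3): matrices that
  -- are triple Riordan arrays whose j-th multiplier function is z.
  AlmostAppell : Fin 3 → Mat → Set
  AlmostAppell j M = Σ TR λ T → (f̂ T j ≋ Z) × (array T ≈M M)

  χ : DR → TR
  χ (kR g g∈ f f∈) = kR g g∈ fs fs∈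
    where
      fs : Fin 3 → FPS
      fs F.zero             = Z
      fs (F.suc F.zero)   = f F.zero
      fs (F.suc (F.suc _)) = f (F.suc F.zero)
      Z∈ : InF1 Z
      Z∈ = refl , 1≉0
      fs∈ : ∀ i → InF1 (fs i)
      fs∈ F.zero                = Z∈
      fs∈ (F.suc F.zero)      = f∈ F.zero
      fs∈ (F.suc (F.suc _))   = f∈ (F.suc F.zero)

  -- ψ : DR → TR is a group monomorphism (on the matrix level) whose image
  -- is exactly the type-j almost Appell subgroup
  IsIsoOnto : (DR → TR) → Fin 3 → Set
  IsIsoOnto ψ j =
      (∀ A B → array A ≈M array B → array (ψ A) ≈M array (ψ B))
    ×
      (∀ A B C → array C ≈M (array A · array B) →
                 array (ψ C) ≈M (array (ψ A) · array (ψ B)))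
    ×
      (∀ A B → array (ψ A) ≈M array (ψ B) → array A ≈M array B)
    ×
      (∀ A → AlmostAppell j (array (ψ A)))
    ×
      (∀ M → AlmostAppell j M → Σ DR λ A → array (ψ A) ≈M M)

-- Column j of a k-Riordan array is g̃(zᵏ) f̂₁(zᵏ) ⋯ f̂ⱼ(zᵏ) / z^((k-1) j), so its entries vanish
-- off the rows ≡ j (mod k), and matrix products split along residue classes mod k. In χ A the
-- multiplier z only shifts coefficients: restricted to rows and columns ≡ t (mod 3), the
-- triple array of χ A is the double array of A restricted to one residue class mod 2, and both
-- classes mod 2 occur. Hence χ respects equality and products of arrays and is injective; a
-- triple array whose first multiplier is z is χ of the double array built from its other two
-- multipliers. Placing z second or third instead gives the type-2 and type-3 statements.

module Submission where

open import Data.Empty using (⊥-elim)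
open import Data.Fin as Fin using (Fin; zero; suc; toℕ; #_)
import Data.Fin.Properties as Finₚ
open import Data.Nat as ℕ using (ℕ; zero; suc; z≤n; s≤s; s<s; _+_; _*_; _∸_; _≤_; _<_; NonZero)
import Data.Nat.Properties as ℕₚ
open import Data.Nat.DivMod
  using ( _/_; _%_; _mod_; DivMod; _divMod_; m≡m%n+[m/n]*n; [m+kn]%n≡m%n; m<n⇒m%n≡m; m%n<n
        ; m*n%n≡0; m*n/n≡m; %-remove-+ˡ; m*n≤o⇒[o∸m*n]%n≡o%n )
open import Data.Nat.Divisibility using (m%n≡0⇒n∣m)
open import Data.Nat.Tactic.RingSolver using (solve-∀)
open import Data.Product using (Σ; ∃; _×_; _,_; proj₁)
open import Data.Sum using (_⊎_; inj₁; inj₂)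
open import Relation.Binary.PropositionalEquality as ≡ using (_≡_; _≢_; refl)
open import Relation.Nullary using (Dec; yes; no)
open import Defs

module _ (k : ℕ) .{{_ : NonZero k}} where

  [t+q*k]%k≡t : ∀ q (t : Fin k) → (toℕ t + q * k) % k ≡ toℕ t
  [t+q*k]%k≡t q t = ≡.trans ([m+kn]%n≡m%n (toℕ t) q k) (m<n⇒m%n≡m (Finₚ.toℕ<n t))

  [t+q*k]mod-k≡t : ∀ q (t : Fin k) → (toℕ t + q * k) mod k ≡ t
  [t+q*k]mod-k≡t q t = Finₚ.toℕ-injective (≡.trans (Finₚ.toℕ-fromℕ< (m%n<n _ k)) ([t+q*k]%k≡t q t))

  residues-differ : ∀ {t b : Fin k} r q → t ≢ b → (toℕ t + r * k) % k ≢ (toℕ b + q * k) % k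
  residues-differ {t} {b} r q t≢b ≡% =
    t≢b (Finₚ.toℕ-injective (≡.trans (≡.sym ([t+q*k]%k≡t r t)) (≡.trans ≡% ([t+q*k]%k≡t q b))))

  n%k≡0⇒n≡[n/k]*k : ∀ n → n % k ≡ 0 → n ≡ n / k * k
  n%k≡0⇒n≡[n/k]*k n n%k≡0 = ≡.trans (m≡m%n+[m/n]*n n k) (≡.cong (_+ n / k * k) n%k≡0)

  [n∸i]%k≡n%k : ∀ n i → i % k ≡ 0 → i ≤ n → (n ∸ i) % k ≡ n % k
  [n∸i]%k≡n%k n i i%k≡0 i≤n = begin
    (n ∸ i) % k             ≡⟨ ≡.cong (λ j → (n ∸ j) % k) i≡i/k*k ⟩
    (n ∸ i / k * k) % k     ≡⟨ m*n≤o⇒[o∸m*n]%n≡o%n (i / k) (≡.subst (_≤ n) i≡i/k*k i≤n) ⟩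
    n % k                   ∎
    where
    open ≡.≡-Reasoning
    i≡i/k*k = n%k≡0⇒n≡[n/k]*k i i%k≡0

  divMod-elim : {P : ℕ → Set} → (∀ q (t : Fin k) → P (toℕ t + q * k)) → ∀ n → P n
  divMod-elim {P} p n = ≡.subst P (≡.sym property) (p quotient remainder)
    where open DivMod (n divMod k)

  divMod-elim₂ : {P : ℕ → ℕ → Set} → (∀ r (t : Fin k) q (b : Fin k) → P (toℕ t + r * k) (toℕ b + q * k)) →
                 ∀ n j → P n j
  divMod-elim₂ {P} p n j = divMod-elim {λ n → P n j} (λ r t → divMod-elim {P (toℕ t + r * k)} (p r t) j) n

  %≡⇒<⊎≡+* : ∀ i c → i % k ≡ c % k → i < c ⊎ ∃ λ s → i ≡ c + s * k
  %≡⇒<⊎≡+* i c i%k≡c%k with c / k ℕ.≤? i / k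
  ... | yes c/k≤i/k = inj₂ (i / k ∸ c / k , (begin
    i                                        ≡⟨ m≡m%n+[m/n]*n i k ⟩
    i % k + i / k * k                        ≡⟨ ≡.cong₂ (λ r q → r + q * k) i%k≡c%k (≡.sym (ℕₚ.m+[n∸m]≡n c/k≤i/k)) ⟩
    c % k + (c / k + (i / k ∸ c / k)) * k    ≡⟨ regroup (c % k) (c / k) (i / k ∸ c / k) ⟩
    (c % k + c / k * k) + (i / k ∸ c / k) * k ≡⟨ ≡.cong (_+ (i / k ∸ c / k) * k) (≡.sym (m≡m%n+[m/n]*n c k)) ⟩
    c + (i / k ∸ c / k) * k                  ∎))
    where
    open ≡.≡-Reasoning
    regroup : ∀ r a b → r + (a + b) * k ≡ (r + a * k) + b * k
    regroup r a b = ≡.trans (≡.cong (r +_) (ℕₚ.*-distribʳ-+ k a b)) (≡.sym (ℕₚ.+-assoc r (a * k) (b * k)))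
  ... | no c/k≰i/k = inj₁ (begin-strict
    i                  ≡⟨ m≡m%n+[m/n]*n i k ⟩
    i % k + i / k * k  <⟨ ℕₚ.+-monoˡ-< (i / k * k) (m%n<n i k) ⟩
    suc (i / k) * k    ≤⟨ ℕₚ.*-monoˡ-≤ k (ℕₚ.≰⇒> c/k≰i/k) ⟩
    c / k * k          ≤⟨ ℕₚ.m≤n+m (c / k * k) (c % k) ⟩
    c % k + c / k * k  ≡⟨ ≡.sym (m≡m%n+[m/n]*n c k) ⟩
    c                  ∎)
    where open ℕₚ.≤-Reasoning

[n+m]∸i≤m : ∀ {n m i} → n < i → (n + m) ∸ i ≤ m
[n+m]∸i≤m {n} {m} n<i =
  ℕₚ.≤-trans (ℕₚ.∸-monoʳ-≤ (n + m) (ℕₚ.<⇒≤ n<i)) (ℕₚ.≤-reflexive (ℕₚ.m+n∸m≡n n m))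

[j*m+n]%[1+m]≡0⇒n%[1+m]≡j%[1+m] : ∀ m n j → (j * m + n) % suc m ≡ 0 → n % suc m ≡ j % suc m
[j*m+n]%[1+m]≡0⇒n%[1+m]≡j%[1+m] m n j ≡0 = begin
  n % suc m                 ≡⟨ ≡.sym ([m+kn]%n≡m%n n j (suc m)) ⟩
  (n + j * suc m) % suc m   ≡⟨ ≡.cong (_% suc m) (regroup m n j) ⟩
  ((j * m + n) + j) % suc m ≡⟨ %-remove-+ˡ j (m%n≡0⇒n∣m (j * m + n) (suc m) ≡0) ⟩
  j % suc m                 ∎
  where
  open ≡.≡-Reasoning
  regroup : ∀ m n j → n + j * suc m ≡ (j * m + n) + j
  regroup = solve-∀

module Series (K : ACF0) where
  open ACF0 K hiding (zero)
    renaming (_+_ to _+ᴷ_; _*_ to _*ᴷ_; refl to ≈-refl; sym to ≈-sym; trans to ≈-trans)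
  open Riordan K
  open import Relation.Binary.Reasoning.Setoid setoid

  x≈0⇒x*y≈0 : ∀ {a} b → a ≈ 0# → a *ᴷ b ≈ 0#
  x≈0⇒x*y≈0 b a≈0 = ≈-trans (*-cong a≈0 ≈-refl) (zeroˡ b)

  y≈0⇒x*y≈0 : ∀ a {b} → b ≈ 0# → a *ᴷ b ≈ 0#
  y≈0⇒x*y≈0 a b≈0 = ≈-trans (*-cong ≈-refl b≈0) (zeroʳ a)

  Σ≤-cong : ∀ n {f g : ℕ → Carrier} → (∀ i → i ≤ n → f i ≈ g i) → Σ≤ n f ≈ Σ≤ n g
  Σ≤-cong zero    f≈g = f≈g 0 z≤n
  Σ≤-cong (suc n) f≈g =
    +-cong (Σ≤-cong n (λ i i≤n → f≈g i (ℕₚ.m≤n⇒m≤1+n i≤n))) (f≈g (suc n) ℕₚ.≤-refl)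

  Σ≤-vanish : ∀ n {h : ℕ → Carrier} → (∀ i → i ≤ n → h i ≈ 0#) → Σ≤ n h ≈ 0#
  Σ≤-vanish zero    h≈0 = h≈0 0 z≤n
  Σ≤-vanish (suc n) h≈0 =
    ≈-trans (+-cong (Σ≤-vanish n (λ i i≤n → h≈0 i (ℕₚ.m≤n⇒m≤1+n i≤n))) (h≈0 (suc n) ℕₚ.≤-refl))
            (+-identityˡ 0#)

  Σ≤-last : ∀ n {h : ℕ → Carrier} → (∀ i → i < n → h i ≈ 0#) → Σ≤ n h ≈ h n
  Σ≤-last zero          _   = ≈-refl
  Σ≤-last (suc n) {h} h≈0 =
    ≈-trans (+-cong (Σ≤-vanish n (λ i i≤n → h≈0 i (s≤s i≤n))) ≈-refl) (+-identityˡ (h (suc n)))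

  Σ≤-truncate : ∀ n e {h : ℕ → Carrier} → (∀ i → n < i → i ≤ n + e → h i ≈ 0#) → Σ≤ (n + e) h ≈ Σ≤ n h
  Σ≤-truncate n zero    _   rewrite ℕₚ.+-identityʳ n = ≈-refl
  Σ≤-truncate n (suc e) h≈0 rewrite ℕₚ.+-suc n e =
    ≈-trans (+-cong (Σ≤-truncate n e (λ i n<i i≤n+e → h≈0 i n<i (ℕₚ.m≤n⇒m≤1+n i≤n+e)))
                    (h≈0 (suc (n + e)) (s≤s (ℕₚ.m≤m+n n e)) ℕₚ.≤-refl))
            (+-identityʳ _)

  Σ≤-dropInitial : ∀ n i {h : ℕ → Carrier} → (∀ j → j < n → h j ≈ 0#) →
                   Σ≤ (n + i) h ≈ Σ≤ i (λ j → h (n + j))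
  Σ≤-dropInitial n zero    h≈0 rewrite ℕₚ.+-identityʳ n = Σ≤-last n h≈0
  Σ≤-dropInitial n (suc i) h≈0 rewrite ℕₚ.+-suc n i = +-cong (Σ≤-dropInitial n i h≈0) ≈-refl

  Σ≤-sparse : ∀ m c r {h : ℕ → Carrier} → (∀ i → (∀ s → i ≢ c + s * suc m) → h i ≈ 0#) →
              Σ≤ (c + r * suc m) h ≈ Σ≤ r (λ s → h (c + s * suc m))
  Σ≤-sparse m c zero {h} h≈0 rewrite ℕₚ.+-identityʳ c =
    Σ≤-last c λ i i<c → h≈0 i λ s i≡ → ℕₚ.<⇒≱ i<c (≡.subst (c ≤_) (≡.sym i≡) (ℕₚ.m≤m+n c (s * suc m)))
  Σ≤-sparse m c (suc r) {h} h≈0 = begin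
    Σ≤ (c + suc r * suc m) h                   ≡⟨ ≡.cong (λ x → Σ≤ x h) next ⟩
    Σ≤ (suc (n + m)) h                         ≈⟨ +-cong (Σ≤-truncate n m gap) ≈-refl ⟩
    Σ≤ n h +ᴷ h (suc (n + m))                  ≈⟨ +-cong (Σ≤-sparse m c r h≈0) (reflexive (≡.cong h (≡.sym next))) ⟩
    Σ≤ r (λ s → h (c + s * suc m)) +ᴷ h (c + suc r * suc m) ∎
    where
    n = c + r * suc m
    regroup : ∀ m c r → c + suc r * suc m ≡ suc ((c + r * suc m) + m)
    regroup = solve-∀
    next : c + suc r * suc m ≡ suc (n + m)
    next = regroup m c r
    gap : ∀ i → n < i → i ≤ n + m → h i ≈ 0#
    gap i n<i i≤n+m = h≈0 i λ s i≡ →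
      let r<s = ℕₚ.*-cancelʳ-< (suc m) r s (ℕₚ.+-cancelˡ-< c (r * suc m) (s * suc m) (≡.subst (n <_) i≡ n<i))
          s*k≤r*k+m = ℕₚ.+-cancelˡ-≤ c (s * suc m) (r * suc m + m)
                        (≡.subst₂ _≤_ i≡ (ℕₚ.+-assoc c (r * suc m) m) i≤n+m)
          s<1+r = ℕₚ.*-cancelʳ-< (suc m) s (suc r)
                    (s≤s (≡.subst (s * suc m ≤_) (ℕₚ.+-comm (r * suc m) m) s*k≤r*k+m))
      in ℕₚ.<⇒≱ r<s (ℕₚ.m<1+n⇒m≤n s<1+r)

  ⋆-cong : ∀ {a a′ b b′} → a ≋ a′ → b ≋ b′ → (a ⋆ b) ≋ (a′ ⋆ b′)
  ⋆-cong a≋a′ b≋b′ n = Σ≤-cong n (λ i _ → *-cong (a≋a′ i) (b≋b′ (n ∸ i)))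

  OrderAtLeast : ℕ → FPS → Set
  OrderAtLeast o a = ∀ i → i < o → a i ≈ 0#

  module _ (m : ℕ) where

    spread-cong : ∀ {a b} → a ≋ b → spread m a ≋ spread m b
    spread-cong a≋b n with n % suc m ℕ.≟ 0
    ... | yes _ = a≋b (n / suc m)
    ... | no  _ = ≈-refl

    spread-off : ∀ x n → n % suc m ≢ 0 → spread m x n ≈ 0#
    spread-off x n n%k≢0 with n % suc m ℕ.≟ 0
    ... | yes n%k≡0 = ⊥-elim (n%k≢0 n%k≡0)
    ... | no  _     = ≈-refl

    spread-offMultiples : ∀ x n → (∀ q → n ≢ q * suc m) → spread m x n ≈ 0#
    spread-offMultiples x n notMultiple =
      spread-off x n λ n%k≡0 → notMultiple (n / suc m) (n%k≡0⇒n≡[n/k]*k (suc m) n n%k≡0)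

    spread-atMultiple : ∀ x q → spread m x (q * suc m) ≈ x q
    spread-atMultiple x q with (q * suc m) % suc m ℕ.≟ 0
    ... | yes _         = reflexive (≡.cong x (m*n/n≡m q (suc m)))
    ... | no  q*k%k≢0 = ⊥-elim (q*k%k≢0 (m*n%n≡0 q (suc m)))

    spread-order : ∀ o x → OrderAtLeast o x → OrderAtLeast (o * suc m) (spread m x)
    spread-order o x ord i i<o*k with i % suc m ℕ.≟ 0
    ... | no  _     = ≈-refl
    ... | yes i%k≡0 = ord (i / suc m) (ℕₚ.*-cancelʳ-< (suc m) (i / suc m) o
                        (≡.subst (_< o * suc m) (n%k≡0⇒n≡[n/k]*k (suc m) i i%k≡0) i<o*k))

    spread-⋆ : ∀ a b → (spread m a ⋆ spread m b) ≋ spread m (a ⋆ b)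
    spread-⋆ a b n with n % suc m ℕ.≟ 0
    ... | no n%k≢0 = Σ≤-vanish n term≈0
      where
      term≈0 : ∀ i → i ≤ n → spread m a i *ᴷ spread m b (n ∸ i) ≈ 0#
      term≈0 i i≤n = byResidue (i % suc m ℕ.≟ 0)
        where
        byResidue : Dec (i % suc m ≡ 0) → spread m a i *ᴷ spread m b (n ∸ i) ≈ 0#
        byResidue (no  i%k≢0) = x≈0⇒x*y≈0 _ (spread-off a i i%k≢0)
        byResidue (yes i%k≡0) = y≈0⇒x*y≈0 _ (spread-off b (n ∸ i) λ [n∸i]%k≡0 →
          n%k≢0 (≡.trans (≡.sym ([n∸i]%k≡n%k (suc m) n i i%k≡0 i≤n)) [n∸i]%k≡0))
    ... | yes n%k≡0 = ≈-trans (reflexive (≡.cong (spread m a ⋆ spread m b) (n%k≡0⇒n≡[n/k]*k (suc m) n n%k≡0)))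
                                (atMultiple (n / suc m))
      where
      atMultiple : ∀ r → (spread m a ⋆ spread m b) (r * suc m) ≈ (a ⋆ b) r
      atMultiple r = begin
        Σ≤ (r * suc m) h
          ≈⟨ Σ≤-sparse m 0 r (λ i notMultiple → x≈0⇒x*y≈0 _ (spread-offMultiples a i notMultiple)) ⟩
        Σ≤ r (λ s → h (s * suc m))
          ≈⟨ Σ≤-cong r (λ s _ → *-cong (spread-atMultiple a s) (b-term s)) ⟩
        Σ≤ r (λ s → a s *ᴷ b (r ∸ s))
          ∎
        where
        h : ℕ → Carrier
        h i = spread m a i *ᴷ spread m b (r * suc m ∸ i)
        b-term : ∀ s → spread m b (r * suc m ∸ s * suc m) ≈ b (r ∸ s)
        b-term s = ≈-trans (reflexive (≡.cong (spread m b) (≡.sym (ℕₚ.*-distribʳ-∸ (suc m) r s))))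
                           (spread-atMultiple b (r ∸ s))

  -- g̃ f̂₁ ⋯ f̂ⱼ; column j of the array is this series at z^k divided by z^((k-1) j).
  reducedColumn : ∀ {m} → KRiordan m → ℕ → FPS
  reducedColumn X zero          = g̃ X
  reducedColumn {m} X (suc j)   = reducedColumn X j ⋆ f̂ X (j mod suc m)

  reducedColumn-cong : ∀ {m} {X Y : KRiordan m} → g̃ X ≋ g̃ Y → (∀ i → f̂ X i ≋ f̂ Y i) →
                       ∀ j → reducedColumn X j ≋ reducedColumn Y j
  reducedColumn-cong g̃≋ f̂≋ zero          = g̃≋
  reducedColumn-cong {m} g̃≋ f̂≋ (suc j)   = ⋆-cong (reducedColumn-cong g̃≋ f̂≋ j) (f̂≋ (j mod suc m))

  reducedColumn-order : ∀ {m} (X : KRiordan m) j → OrderAtLeast j (reducedColumn X j)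
  reducedColumn-order X zero    i ()
  reducedColumn-order {m} X (suc j) i i<1+j = Σ≤-vanish i term≈0
    where
    f = f̂ X (j mod suc m)
    term≈0 : ∀ l → l ≤ i → reducedColumn X j l *ᴷ f (i ∸ l) ≈ 0#
    term≈0 l l≤i with l ℕ.<? j
    ... | yes l<j = x≈0⇒x*y≈0 _ (reducedColumn-order X j l l<j)
    ... | no  l≮j = y≈0⇒x*y≈0 _ (≈-trans (reflexive (≡.cong f (ℕₚ.m≤n⇒m∸n≡0 i≤l))) (proj₁ (f̂∈F1 X _)))
      where i≤l = ℕₚ.≤-trans (ℕₚ.m<1+n⇒m≤n i<1+j) (ℕₚ.≮⇒≥ l≮j)

  array≈spread-reducedColumn : ∀ {m} (X : KRiordan m) n j →
                               array X n j ≈ spread m (reducedColumn X j) (j * m + n)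
  array≈spread-reducedColumn {m} X n zero    = ≈-refl
  array≈spread-reducedColumn {m} X n (suc j) = begin
    Σ≤ n (λ i → column X j i *ᴷ spread m f ((n ∸ i) + m))
      ≈⟨ Σ≤-cong n (λ i i≤n → *-cong (array≈spread-reducedColumn X i j)
                                      (reflexive (≡.cong (spread m f) (f-index i i≤n)))) ⟩
    Σ≤ n (λ i → h (j * m + i))       ≈⟨ Σ≤-truncate n m tail≈0 ⟨
    Σ≤ (n + m) (λ i → h (j * m + i)) ≈⟨ Σ≤-dropInitial (j * m) (n + m) head≈0 ⟨
    Σ≤ (j * m + (n + m)) h          ≡⟨ ≡.cong (λ x → Σ≤ x h) (regroup n j m) ⟩
    (spread m P ⋆ spread m f) M     ≈⟨ spread-⋆ m P f M ⟩
    spread m (P ⋆ f) M              ∎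
    where
    P = reducedColumn X j
    f = f̂ X (j mod suc m)
    M = suc j * m + n
    h : ℕ → Carrier
    h l = spread m P l *ᴷ spread m f (M ∸ l)
    regroup : ∀ n j m → j * m + (n + m) ≡ suc j * m + n
    regroup = solve-∀
    M∸[j*m+i]≡[n+m]∸i : ∀ i → M ∸ (j * m + i) ≡ (n + m) ∸ i
    M∸[j*m+i]≡[n+m]∸i i =
      ≡.trans (≡.cong (_∸ (j * m + i)) (≡.sym (regroup n j m))) (ℕₚ.[m+n]∸[m+o]≡n∸o (j * m) (n + m) i)
    f-index : ∀ i → i ≤ n → (n ∸ i) + m ≡ M ∸ (j * m + i)
    f-index i i≤n = ≡.sym (≡.trans (M∸[j*m+i]≡[n+m]∸i i) (ℕₚ.+-∸-comm m i≤n))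
    f-order : OrderAtLeast 1 f
    f-order zero    _        = proj₁ (f̂∈F1 X _)
    f-order (suc _) (s<s ())
    tail≈0 : ∀ i → n < i → i ≤ n + m → h (j * m + i) ≈ 0#
    tail≈0 i n<i _ = y≈0⇒x*y≈0 _ (spread-order m 1 f f-order (M ∸ (j * m + i))
      (≡.subst (_< 1 * suc m) (≡.sym (M∸[j*m+i]≡[n+m]∸i i))
        (≡.subst ((n + m) ∸ i <_) (≡.sym (ℕₚ.*-identityˡ (suc m)))
          (s≤s ([n+m]∸i≤m n<i)))))
    head≈0 : ∀ l → l < j * m → h l ≈ 0#
    head≈0 l l<j*m = x≈0⇒x*y≈0 _ (spread-order m j P (reducedColumn-order X j) l
      (ℕₚ.<-≤-trans l<j*m (ℕₚ.*-monoʳ-≤ j (ℕₚ.n≤1+n m))))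

  array-cong : ∀ {m} {X Y : KRiordan m} → g̃ X ≋ g̃ Y → (∀ i → f̂ X i ≋ f̂ Y i) → array X ≈M array Y
  array-cong {m} {X} {Y} g̃≋ f̂≋ n j = begin
    array X n j                                  ≈⟨ array≈spread-reducedColumn X n j ⟩
    spread m (reducedColumn X j) (j * m + n)     ≈⟨ spread-cong m (reducedColumn-cong g̃≋ f̂≋ j) (j * m + n) ⟩
    spread m (reducedColumn Y j) (j * m + n)     ≈⟨ array≈spread-reducedColumn Y n j ⟨
    array Y n j                                  ∎

  array-lowerTriangular : ∀ {m} (X : KRiordan m) {n j} → n < j → array X n j ≈ 0#
  array-lowerTriangular {m} X {n} {j} n<j =
    ≈-trans (array≈spread-reducedColumn X n j)
            (spread-order m j (reducedColumn X j) (reducedColumn-order X j) (j * m + n)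
              (≡.subst (j * m + n <_) j*m+j≡j*k (ℕₚ.+-monoʳ-< (j * m) n<j)))
    where j*m+j≡j*k = ≡.trans (ℕₚ.+-comm (j * m) j) (≡.sym (ℕₚ.*-suc j m))

  array-offResidue : ∀ {m} (X : KRiordan m) n j → n % suc m ≢ j % suc m → array X n j ≈ 0#
  array-offResidue {m} X n j n≢j =
    ≈-trans (array≈spread-reducedColumn X n j)
            (spread-off m (reducedColumn X j) (j * m + n) (λ ≡0 → n≢j ([j*m+n]%[1+m]≡0⇒n%[1+m]≡j%[1+m] m n j ≡0)))

  ·-offResidue : ∀ {m} (X Y : KRiordan m) n j → n % suc m ≢ j % suc m → (array X · array Y) n j ≈ 0#
  ·-offResidue {m} X Y n j n≢j = Σ≤-vanish n term≈0
    where
    term≈0 : ∀ i → i ≤ n → array X n i *ᴷ array Y i j ≈ 0#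
    term≈0 i _ with n % suc m ℕ.≟ i % suc m
    ... | no  n≢i = x≈0⇒x*y≈0 _ (array-offResidue X n i n≢i)
    ... | yes n≡i = y≈0⇒x*y≈0 _ (array-offResidue Y i j (λ i≡j → n≢j (≡.trans n≡i i≡j)))

  ·-onResidue : ∀ {m} (X Y : KRiordan m) c r q →
                (array X · array Y) (c + r * suc m) (c + q * suc m)
                ≈ Σ≤ r (λ s → array X (c + r * suc m) (c + s * suc m) *ᴷ array Y (c + s * suc m) (c + q * suc m))
  ·-onResidue {m} X Y c r q = Σ≤-sparse m c r term≈0
    where
    n = c + r * suc m
    j = c + q * suc m
    term≈0 : ∀ i → (∀ s → i ≢ c + s * suc m) → array X n i *ᴷ array Y i j ≈ 0#
    term≈0 i notOnResidue with i % suc m ℕ.≟ c % suc m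
    ... | no  i≢c =
      x≈0⇒x*y≈0 _ (array-offResidue X n i (λ n≡i → i≢c (≡.trans (≡.sym n≡i) ([m+kn]%n≡m%n c r (suc m)))))
    ... | yes i≡c with %≡⇒<⊎≡+* (suc m) i c i≡c
    ...   | inj₁ i<c      = y≈0⇒x*y≈0 _ (array-lowerTriangular Y (ℕₚ.<-≤-trans i<c (ℕₚ.m≤m+n c (q * suc m))))
    ...   | inj₂ (s , i≡) = ⊥-elim (notOnResidue s i≡)

  record Shifted (n : ℕ) (x y : FPS) : Set where
    constructor shifted
    field
      order       : OrderAtLeast n x
      coefficient : ∀ i → x (n + i) ≈ y i

  shifted-refl : ∀ x → Shifted 0 x x
  shifted-refl x = shifted (λ _ ()) (λ _ → ≈-refl)

  ⋆Z-coefficient : ∀ x l → (x ⋆ Z) (suc l) ≈ x l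
  ⋆Z-coefficient x l = begin
    Σ≤ l h +ᴷ h (suc l)         ≈⟨ +-cong (Σ≤-last l (λ i i<l → y≈0⇒x*y≈0 _ (reflexive (Z-beyond-1 i<l))))
                                          (y≈0⇒x*y≈0 _ (reflexive (≡.cong Z (ℕₚ.n∸n≡0 l)))) ⟩
    h l +ᴷ 0#                   ≈⟨ +-identityʳ (h l) ⟩
    x l *ᴷ Z (suc l ∸ l)        ≡⟨ ≡.cong (λ e → x l *ᴷ Z e) (ℕₚ.m+n∸n≡m 1 l) ⟩
    x l *ᴷ 1#                   ≈⟨ *-identityʳ (x l) ⟩
    x l                         ∎
    where
    h : ℕ → Carrier
    h i = x i *ᴷ Z (suc l ∸ i)
    Z-beyond-1 : ∀ {i l} → i < l → Z (suc l ∸ i) ≡ 0#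
    Z-beyond-1 {zero}  {suc l} _          = refl
    Z-beyond-1 {suc i} {suc l} (s<s i<l) = Z-beyond-1 i<l

  shifted-⋆Z : ∀ {n x y} → Shifted n x y → Shifted (suc n) (x ⋆ Z) y
  shifted-⋆Z {n} {x} {y} (shifted x-order x≈y) = shifted xZ-order λ i → ≈-trans (⋆Z-coefficient x (n + i)) (x≈y i)
    where
    xZ-order : OrderAtLeast (suc n) (x ⋆ Z)
    xZ-order zero    _         = zeroʳ _
    xZ-order (suc l) (s<s l<n) = ≈-trans (⋆Z-coefficient x l) (x-order l l<n)

  shifted-⋆ : ∀ {n x y} → Shifted n x y → ∀ f → Shifted n (x ⋆ f) (y ⋆ f)
  shifted-⋆ {n} {x} {y} (shifted x-order x≈y) f = shifted xf-order xf≈yf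
    where
    xf-order : OrderAtLeast n (x ⋆ f)
    xf-order l l<n = Σ≤-vanish l (λ i i≤l → x≈0⇒x*y≈0 _ (x-order i (ℕₚ.≤-<-trans i≤l l<n)))
    xf≈yf : ∀ i → (x ⋆ f) (n + i) ≈ (y ⋆ f) i
    xf≈yf i = ≈-trans (Σ≤-dropInitial n i (λ j j<n → x≈0⇒x*y≈0 _ (x-order j j<n)))
                      (Σ≤-cong i (λ j _ → *-cong (x≈y j) (reflexive (≡.cong f (ℕₚ.[m+n]∸[m+o]≡n∸o n i j)))))

module Embeddings (K : ACF0) where
  open ACF0 K hiding (zero)
    renaming (_+_ to _+ᴷ_; _*_ to _*ᴷ_; refl to ≈-refl; sym to ≈-sym; trans to ≈-trans)
  open Riordan K
  open Series K
  open import Relation.Binary.Reasoning.Setoid setoid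

  entry-transfer : ∀ (T : TR) (D : DR) n j j′ → Shifted n (reducedColumn T j) (reducedColumn D j′) →
                   ∀ i N N′ → j * 2 + N ≡ (n + i) * 3 → j′ * 1 + N′ ≡ i * 2 → array T N j ≈ array D N′ j′
  entry-transfer T D n j j′ (shifted _ shift) i N N′ T-index D-index = begin
    array T N j                                   ≈⟨ array≈spread-reducedColumn T N j ⟩
    spread 2 (reducedColumn T j) (j * 2 + N)     ≡⟨ ≡.cong (spread 2 (reducedColumn T j)) T-index ⟩
    spread 2 (reducedColumn T j) ((n + i) * 3)   ≈⟨ spread-atMultiple 2 _ (n + i) ⟩
    reducedColumn T j (n + i)                     ≈⟨ shift i ⟩
    reducedColumn D j′ i                          ≈⟨ spread-atMultiple 1 _ i ⟨
    spread 1 (reducedColumn D j′) (i * 2)         ≡⟨ ≡.cong (spread 1 (reducedColumn D j′)) D-index ⟨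
    spread 1 (reducedColumn D j′) (j′ * 1 + N′)   ≈⟨ array≈spread-reducedColumn D N′ j′ ⟨
    array D N′ j′                                 ∎

  -- Of the first t multipliers of ψ A, `zerosBefore t` are z and `residue t` are those of A, so
  -- reduced columns of ψ A are shifted reduced columns of A; consequently the triple array of ψ A
  -- on rows and columns ≡ t (mod 3) is the double array of A on rows and columns ≡ residue t (mod 2).
  record Interleaving (ψ : DR → TR) (p : Fin 3) : Set where
    field
      residue               : Fin 3 → ℕ
      zerosBefore           : Fin 3 → ℕ
      residue+zerosBefore   : ∀ t → residue t + zerosBefore t ≡ toℕ t
      residue-onto          : ∀ (a : Fin 2) → ∃ λ t → residue t ≡ toℕ a
      reducedColumn-shifted : ∀ A q t → Shifted (zerosBefore t + q) (reducedColumn (ψ A) (toℕ t + q * 3))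
                                                                    (reducedColumn A (residue t + q * 2))
      multiplier-z          : ∀ A → f̂ (ψ A) p ≋ Z
      retract               : TR → DR
      retract-g̃             : ∀ T → g̃ (ψ (retract T)) ≋ g̃ T
      retract-f̂             : ∀ T → f̂ T p ≋ Z → ∀ i → f̂ (ψ (retract T)) i ≋ f̂ T i

  module _ {ψ : DR → TR} {p : Fin 3} (I : Interleaving ψ p) where
    open Interleaving I

    interleaving-diagonal : ∀ A r q t →
      array (ψ A) (toℕ t + r * 3) (toℕ t + q * 3) ≈ array A (residue t + r * 2) (residue t + q * 2)
    interleaving-diagonal A r q t =
      entry-transfer (ψ A) A (zerosBefore t + q) (toℕ t + q * 3) (residue t + q * 2) (reducedColumn-shifted A q t)
                     (residue t + (r + q)) (toℕ t + r * 3) (residue t + r * 2)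
        (≡.subst (λ u → (u + q * 3) * 2 + (u + r * 3) ≡ ((zerosBefore t + q) + (residue t + (r + q))) * 3)
                 (residue+zerosBefore t) (triple-index (residue t) (zerosBefore t) q r))
        (double-index (residue t) q r)
      where
      triple-index : ∀ c z q r → ((c + z) + q * 3) * 2 + ((c + z) + r * 3) ≡ ((z + q) + (c + (r + q))) * 3
      triple-index = solve-∀
      double-index : ∀ c q r → (c + q * 2) * 1 + (c + r * 2) ≡ (c + (r + q)) * 2
      double-index = solve-∀

    interleaving-offDiagonal : ∀ A r q {t b : Fin 3} → t ≢ b → array (ψ A) (toℕ t + r * 3) (toℕ b + q * 3) ≈ 0#
    interleaving-offDiagonal A r q {t} {b} t≢b =
      array-offResidue (ψ A) (toℕ t + r * 3) (toℕ b + q * 3) (residues-differ 3 r q t≢b)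

    interleaving-respects : ∀ A B → array A ≈M array B → array (ψ A) ≈M array (ψ B)
    interleaving-respects A B A≈B = divMod-elim₂ 3 entry
      where
      entry : ∀ r t q b → array (ψ A) (toℕ t + r * 3) (toℕ b + q * 3) ≈ array (ψ B) (toℕ t + r * 3) (toℕ b + q * 3)
      entry r t q b with t Fin.≟ b
      ... | yes refl = begin
        array (ψ A) (toℕ t + r * 3) (toℕ t + q * 3)   ≈⟨ interleaving-diagonal A r q t ⟩
        array A (residue t + r * 2) (residue t + q * 2) ≈⟨ A≈B (residue t + r * 2) (residue t + q * 2) ⟩
        array B (residue t + r * 2) (residue t + q * 2) ≈⟨ interleaving-diagonal B r q t ⟨
        array (ψ B) (toℕ t + r * 3) (toℕ t + q * 3)   ∎
      ... | no t≢b = ≈-trans (interleaving-offDiagonal A r q t≢b) (≈-sym (interleaving-offDiagonal B r q t≢b))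


    interleaving-homomorphic : ∀ A B C → array C ≈M (array A · array B) → array (ψ C) ≈M (array (ψ A) · array (ψ B))
    interleaving-homomorphic A B C C≈AB = divMod-elim₂ 3 entry
      where
      entry : ∀ r t q b → array (ψ C) (toℕ t + r * 3) (toℕ b + q * 3)
                          ≈ (array (ψ A) · array (ψ B)) (toℕ t + r * 3) (toℕ b + q * 3)
      entry r t q b with t Fin.≟ b
      ... | yes refl = let c = residue t; t′ = toℕ t in begin
        array (ψ C) (t′ + r * 3) (t′ + q * 3)
          ≈⟨ interleaving-diagonal C r q t ⟩
        array C (c + r * 2) (c + q * 2)
          ≈⟨ C≈AB (c + r * 2) (c + q * 2) ⟩
        (array A · array B) (c + r * 2) (c + q * 2)
          ≈⟨ ·-onResidue A B c r q ⟩
        Σ≤ r (λ s → array A (c + r * 2) (c + s * 2) *ᴷ array B (c + s * 2) (c + q * 2))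
          ≈⟨ Σ≤-cong r (λ s _ → *-cong (interleaving-diagonal A r s t) (interleaving-diagonal B s q t)) ⟨
        Σ≤ r (λ s → array (ψ A) (t′ + r * 3) (t′ + s * 3) *ᴷ array (ψ B) (t′ + s * 3) (t′ + q * 3))
          ≈⟨ ·-onResidue (ψ A) (ψ B) t′ r q ⟨
        (array (ψ A) · array (ψ B)) (t′ + r * 3) (t′ + q * 3) ∎
      ... | no t≢b = ≈-trans (interleaving-offDiagonal C r q t≢b)
                             (≈-sym (·-offResidue (ψ A) (ψ B) (toℕ t + r * 3) (toℕ b + q * 3) (residues-differ 3 r q t≢b)))


    interleaving-injective : ∀ A B → array (ψ A) ≈M array (ψ B) → array A ≈M array B
    interleaving-injective A B ψA≈ψB = divMod-elim₂ 2 entry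
      where
      entry : ∀ r a q b → array A (toℕ a + r * 2) (toℕ b + q * 2) ≈ array B (toℕ a + r * 2) (toℕ b + q * 2)
      entry r a q b with a Fin.≟ b
      ... | no a≢b   = ≈-trans (array-offResidue A n j (residues-differ 2 r q a≢b))
                               (≈-sym (array-offResidue B n j (residues-differ 2 r q a≢b)))
        where
        n = toℕ a + r * 2
        j = toℕ b + q * 2
      ... | yes refl with residue-onto a
      ...   | t , c≡a rewrite ≡.sym c≡a = begin
        array A (residue t + r * 2) (residue t + q * 2) ≈⟨ interleaving-diagonal A r q t ⟨
        array (ψ A) (toℕ t + r * 3) (toℕ t + q * 3)   ≈⟨ ψA≈ψB (toℕ t + r * 3) (toℕ t + q * 3) ⟩
        array (ψ B) (toℕ t + r * 3) (toℕ t + q * 3)   ≈⟨ interleaving-diagonal B r q t ⟩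
        array B (residue t + r * 2) (residue t + q * 2) ∎


    interleaving-image⊆ : ∀ A → AlmostAppell p (array (ψ A))
    interleaving-image⊆ A = ψ A , multiplier-z A , λ _ _ → ≈-refl


    interleaving-image⊇ : ∀ M → AlmostAppell p M → Σ DR λ A → array (ψ A) ≈M M
    interleaving-image⊇ M (T , f̂ₚ≋Z , T≈M) =
      retract T , λ n j → ≈-trans (array-cong (retract-g̃ T) (retract-f̂ T f̂ₚ≋Z) n j) (T≈M n j)

    interleaving⇒IsIsoOnto : IsIsoOnto ψ p
    interleaving⇒IsIsoOnto =
      interleaving-respects , interleaving-homomorphic , interleaving-injective , interleaving-image⊆ , interleaving-image⊇

  Z∈F1 : InF1 Z
  Z∈F1 = ≈-refl , 1≉0

  χ₂ : DR → TR
  χ₂ (kR g g∈ f f∈) = kR g g∈ multipliers multipliers∈F1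
    where
    multipliers : Fin 3 → FPS
    multipliers zero             = f zero
    multipliers (suc zero)       = Z
    multipliers (suc (suc zero)) = f (suc zero)
    multipliers∈F1 : ∀ i → InF1 (multipliers i)
    multipliers∈F1 zero             = f∈ zero
    multipliers∈F1 (suc zero)       = Z∈F1
    multipliers∈F1 (suc (suc zero)) = f∈ (suc zero)

  χ₃ : DR → TR
  χ₃ (kR g g∈ f f∈) = kR g g∈ multipliers multipliers∈F1
    where
    multipliers : Fin 3 → FPS
    multipliers zero             = f zero
    multipliers (suc zero)       = f (suc zero)
    multipliers (suc (suc zero)) = Z
    multipliers∈F1 : ∀ i → InF1 (multipliers i)
    multipliers∈F1 zero             = f∈ zero
    multipliers∈F1 (suc zero)       = f∈ (suc zero)
    multipliers∈F1 (suc (suc zero)) = Z∈F1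

  selectMultipliers : TR → Fin 3 → Fin 3 → DR
  selectMultipliers T a b = kR (g̃ T) (g̃∈F0 T) multipliers multipliers∈F1
    where
    multipliers : Fin 2 → FPS
    multipliers zero       = f̂ T a
    multipliers (suc zero) = f̂ T b
    multipliers∈F1 : ∀ i → InF1 (multipliers i)
    multipliers∈F1 zero       = f̂∈F1 T a
    multipliers∈F1 (suc zero) = f̂∈F1 T b

  module ShiftSteps (ψ : DR → TR) (A : DR) where
    private
      RT = reducedColumn (ψ A)
      RD = reducedColumn A

    stepMultiplier : ∀ {n} (t : Fin 3) q (t′ : Fin 2) q′ →
                     Shifted n (RT (toℕ t + q * 3)) (RD (toℕ t′ + q′ * 2)) → f̂ (ψ A) t ≡ f̂ A t′ →
                     Shifted n (RT (suc (toℕ t + q * 3))) (RD (suc (toℕ t′ + q′ * 2)))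
    stepMultiplier {n} t q t′ q′ S f̂ₜ≡f̂ₜ′ = goal
      where
      goal : Shifted n (RT (toℕ t + q * 3) ⋆ f̂ (ψ A) ((toℕ t + q * 3) mod 3))
                       (RD (toℕ t′ + q′ * 2) ⋆ f̂ A ((toℕ t′ + q′ * 2) mod 2))
      goal rewrite [t+q*k]mod-k≡t 3 q t | [t+q*k]mod-k≡t 2 q′ t′ | f̂ₜ≡f̂ₜ′ = shifted-⋆ S (f̂ A t′)

    stepZ : ∀ {n} (t : Fin 3) q j′ →
            Shifted n (RT (toℕ t + q * 3)) (RD j′) → f̂ (ψ A) t ≡ Z →
            Shifted (suc n) (RT (suc (toℕ t + q * 3))) (RD j′)
    stepZ {n} t q j′ S f̂ₜ≡Z = goal
      where
      goal : Shifted (suc n) (RT (toℕ t + q * 3) ⋆ f̂ (ψ A) ((toℕ t + q * 3) mod 3)) (RD j′)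
      goal rewrite [t+q*k]mod-k≡t 3 q t | f̂ₜ≡Z = shifted-⋆Z S

  module χ-Shifts (A : DR) where
    open ShiftSteps χ A
    mutual
      shifted₀ : ∀ q → Shifted q (reducedColumn (χ A) (q * 3)) (reducedColumn A (q * 2))
      shifted₀ zero    = shifted-refl _
      shifted₀ (suc q) = stepMultiplier (# 2) q (# 1) q (shifted₂ q) refl

      shifted₁ : ∀ q → Shifted (suc q) (reducedColumn (χ A) (1 + q * 3)) (reducedColumn A (q * 2))
      shifted₁ q = stepZ (# 0) q (q * 2) (shifted₀ q) refl

      shifted₂ : ∀ q → Shifted (suc q) (reducedColumn (χ A) (2 + q * 3)) (reducedColumn A (1 + q * 2))
      shifted₂ q = stepMultiplier (# 1) q (# 0) q (shifted₁ q) refl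

  module χ₂-Shifts (A : DR) where
    open ShiftSteps χ₂ A
    mutual
      shifted₀ : ∀ q → Shifted q (reducedColumn (χ₂ A) (q * 3)) (reducedColumn A (q * 2))
      shifted₀ zero    = shifted-refl _
      shifted₀ (suc q) = stepMultiplier (# 2) q (# 1) q (shifted₂ q) refl

      shifted₁ : ∀ q → Shifted q (reducedColumn (χ₂ A) (1 + q * 3)) (reducedColumn A (1 + q * 2))
      shifted₁ q = stepMultiplier (# 0) q (# 0) q (shifted₀ q) refl

      shifted₂ : ∀ q → Shifted (suc q) (reducedColumn (χ₂ A) (2 + q * 3)) (reducedColumn A (1 + q * 2))
      shifted₂ q = stepZ (# 1) q (1 + q * 2) (shifted₁ q) refl

  module χ₃-Shifts (A : DR) where
    open ShiftSteps χ₃ A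
    mutual
      shifted₀ : ∀ q → Shifted q (reducedColumn (χ₃ A) (q * 3)) (reducedColumn A (q * 2))
      shifted₀ zero    = shifted-refl _
      shifted₀ (suc q) = stepZ (# 2) q (2 + q * 2) (shifted₂ q) refl

      shifted₁ : ∀ q → Shifted q (reducedColumn (χ₃ A) (1 + q * 3)) (reducedColumn A (1 + q * 2))
      shifted₁ q = stepMultiplier (# 0) q (# 0) q (shifted₀ q) refl

      shifted₂ : ∀ q → Shifted q (reducedColumn (χ₃ A) (2 + q * 3)) (reducedColumn A (2 + q * 2))
      shifted₂ q = stepMultiplier (# 1) q (# 1) q (shifted₁ q) refl

  χ-interleaving : Interleaving χ (# 0)
  χ-interleaving = record
    { residue               = λ { zero → 0 ; (suc zero) → 0 ; (suc (suc zero)) → 1 }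
    ; zerosBefore           = λ { zero → 0 ; (suc zero) → 1 ; (suc (suc zero)) → 1 }
    ; residue+zerosBefore   = λ { zero → refl ; (suc zero) → refl ; (suc (suc zero)) → refl }
    ; residue-onto          = λ { zero → # 0 , refl ; (suc zero) → # 2 , refl }
    ; reducedColumn-shifted = λ { A q zero             → shifted₀ A q
                                ; A q (suc zero)       → shifted₁ A q
                                ; A q (suc (suc zero)) → shifted₂ A q }
    ; multiplier-z          = λ _ _ → ≈-refl
    ; retract               = λ T → selectMultipliers T (# 1) (# 2)
    ; retract-g̃             = λ _ _ → ≈-refl
    ; retract-f̂             = λ { T f̂₀≋Z zero n             → ≈-sym (f̂₀≋Z n)
                                ; _ _    (suc zero) _       → ≈-refl
                                ; _ _    (suc (suc zero)) _ → ≈-refl }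
    }
    where open χ-Shifts

  χ₂-interleaving : Interleaving χ₂ (# 1)
  χ₂-interleaving = record
    { residue               = λ { zero → 0 ; (suc zero) → 1 ; (suc (suc zero)) → 1 }
    ; zerosBefore           = λ { zero → 0 ; (suc zero) → 0 ; (suc (suc zero)) → 1 }
    ; residue+zerosBefore   = λ { zero → refl ; (suc zero) → refl ; (suc (suc zero)) → refl }
    ; residue-onto          = λ { zero → # 0 , refl ; (suc zero) → # 1 , refl }
    ; reducedColumn-shifted = λ { A q zero             → shifted₀ A q
                                ; A q (suc zero)       → shifted₁ A q
                                ; A q (suc (suc zero)) → shifted₂ A q }
    ; multiplier-z          = λ _ _ → ≈-refl
    ; retract               = λ T → selectMultipliers T (# 0) (# 2)
    ; retract-g̃             = λ _ _ → ≈-refl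
    ; retract-f̂             = λ { _ _    zero _             → ≈-refl
                                ; T f̂₁≋Z (suc zero) n       → ≈-sym (f̂₁≋Z n)
                                ; _ _    (suc (suc zero)) _ → ≈-refl }
    }
    where open χ₂-Shifts

  χ₃-interleaving : Interleaving χ₃ (# 2)
  χ₃-interleaving = record
    { residue               = toℕ
    ; zerosBefore           = λ _ → 0
    ; residue+zerosBefore   = λ t → ℕₚ.+-identityʳ (toℕ t)
    ; residue-onto          = λ { zero → # 0 , refl ; (suc zero) → # 1 , refl }
    ; reducedColumn-shifted = λ { A q zero             → shifted₀ A q
                                ; A q (suc zero)       → shifted₁ A q
                                ; A q (suc (suc zero)) → shifted₂ A q }
    ; multiplier-z          = λ _ _ → ≈-refl
    ; retract               = λ T → selectMultipliers T (# 0) (# 1)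
    ; retract-g̃             = λ _ _ → ≈-refl
    ; retract-f̂             = λ { _ _    zero _             → ≈-refl
                                ; _ _    (suc zero) _       → ≈-refl
                                ; T f̂₂≋Z (suc (suc zero)) n → ≈-sym (f̂₂≋Z n) }
    }
    where open χ₃-Shifts

theorem2p2 : (K : ACF0) → let open Riordan K in
    IsIsoOnto χ zero
    × Σ (DR → TR) (λ ψ → IsIsoOnto ψ (suc zero))
    × Σ (DR → TR) (λ ψ → IsIsoOnto ψ (suc (suc zero)))
theorem2p2 K =
    interleaving⇒IsIsoOnto χ-interleaving
  , (χ₂ , interleaving⇒IsIsoOnto χ₂-interleaving)
  , (χ₃ , interleaving⇒IsIsoOnto χ₃-interleaving)
  where open Embeddings K
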